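{- Let $K$ be a field of characteristic $0$, let $r$ be a nonzero integer and $d\ge 2$ an integer with $d-1\neq r$. Let $\phi:\mathbb{P}^1\to\mathbb{P}^1$ be a rational map of degree $d-1$ over $K$ which has $d-1$ distinct affine fixed points $x_1,\ldots,x_{d-1}$, all with multiplier $1-r$, and which fixes $(1:0)$ with multiplier $\frac{d-1}{d-r-1}$. Then the induced affine map is $$\tilde\phi(x)=x-r\,\frac{f(x)}{f'(x)},\qquad f(x)=\prod_{i=1}^{d-1}(x-x_i).$$
   Context: The multiplier of a rational map at a fixed point $P$ is the derivative of the map at $P$ computed in an affine coordinate in which $P$ is finite (for $(1:0)$, first change coordinates, e.g. $x\mapsto 1/x$). -}

module Defs where

open import Level using (Level; _⊔_) renaming (suc to lsuc)
open import Data.Nat using (ℕ; zero; suc; _∸_; _<_)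
open import Data.Integer using (ℤ; +_; -[1+_])
open import Data.Fin using (Fin) renaming (zero to fzero; suc to fsuc)
open import Data.List using (List; []; _∷_; map; upTo)
open import Data.Product using (_×_; ∃; ∃₂)
open import Data.Sum using (_⊎_)
open import Relation.Nullary using (¬_)
open import Relation.Binary.PropositionalEquality using (_≡_)
open import Algebra.Bundles using (CommutativeRing)

record Field (c ℓ : Level) : Set (lsuc (c ⊔ ℓ)) where
  field
    commutativeRing : CommutativeRing c ℓ
  open CommutativeRing commutativeRing public
  field
    1≉0     : ¬ (1# ≈ 0#)
    inverse : ∀ x → ¬ (x ≈ 0#) → ∃ λ y → x * y ≈ 1#

module FieldDefs {c ℓ : Level} (F : Field c ℓ) where
  open Field F

  natK : ℕ → Carrier
  natK zero    = 0#
  natK (suc n) = 1# + natK n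

  intK : ℤ → Carrier
  intK (+ n)      = natK n
  intK -[1+ n ]   = - natK (suc n)

  CharZero : Set ℓ
  CharZero = ∀ n → natK n ≈ 0# → n ≡ 0

  -- Polynomials in one variable: coefficient lists, constant term first.
  Poly : Set c
  Poly = List Carrier

  coeff : Poly → ℕ → Carrier
  coeff []      _       = 0#
  coeff (a ∷ p) zero    = a
  coeff (a ∷ p) (suc n) = coeff p n

  _≈ₚ_ : Poly → Poly → Set ℓ
  p ≈ₚ q = ∀ n → coeff p n ≈ coeff q n

  infixl 6 _+ₚ_ _-ₚ_
  infixl 7 _*ₚ_
  infix 4 _≈ₚ_

  _+ₚ_ : Poly → Poly → Poly
  []      +ₚ q       = q
  (a ∷ p) +ₚ []      = a ∷ p
  (a ∷ p) +ₚ (b ∷ q) = (a + b) ∷ (p +ₚ q)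

  -ₚ_ : Poly → Poly
  -ₚ p = map -_ p

  _-ₚ_ : Poly → Poly → Poly
  p -ₚ q = p +ₚ (-ₚ q)

  scale : Carrier → Poly → Poly
  scale a p = map (a *_) p

  _*ₚ_ : Poly → Poly → Poly
  []      *ₚ q = []
  (a ∷ p) *ₚ q = scale a q +ₚ (0# ∷ (p *ₚ q))

  const : Carrier → Poly
  const a = a ∷ []

  X : Poly
  X = 0# ∷ 1# ∷ []

  derivFrom : ℕ → Poly → Poly
  derivFrom n []      = []
  derivFrom n (b ∷ q) = (natK n * b) ∷ derivFrom (suc n) q

  deriv : Poly → Poly
  deriv []      = []
  deriv (a ∷ p) = derivFrom 1 p

  eval : Poly → Carrier → Carrier
  eval []      x = 0#
  eval (a ∷ p) x = a + x * eval p x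

  DegAtMost : Poly → ℕ → Set ℓ
  DegAtMost p n = ∀ k → n < k → coeff p k ≈ 0#

  -- reversal relative to degree n: x^n p(1/x)
  rev : ℕ → Poly → Poly
  rev n p = map (λ i → coeff p (n ∸ i)) (upTo (suc n))

  -- The rational map P^1 → P^1, (X:Y) ↦ (Y^n P(X/Y) : Y^n Q(X/Y)),
  -- given in the affine chart by x ↦ P(x)/Q(x), has degree n:
  -- max(deg P, deg Q) = n and P, Q coprime in K[x].
  IsRationalMapOfDegree : ℕ → Poly → Poly → Set (c ⊔ ℓ)
  IsRationalMapOfDegree n P Q =
    DegAtMost P n × DegAtMost Q n ×
    (¬ (coeff P n ≈ 0#) ⊎ ¬ (coeff Q n ≈ 0#)) ×
    ∃₂ λ A B → A *ₚ P +ₚ B *ₚ Q ≈ₚ const 1#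

  -- x is an affine fixed point of x ↦ P(x)/Q(x) with multiplier μ:
  -- Q(x) ≠ 0, P(x)/Q(x) = x, and (P/Q)'(x) = (P'Q - PQ')(x)/Q(x)^2 = μ
  -- (cross-multiplied by Q(x)^2 ≠ 0).
  AffineFixedWithMultiplier : Poly → Poly → Carrier → Carrier → Set ℓ
  AffineFixedWithMultiplier P Q x μ =
    ¬ (eval Q x ≈ 0#) ×
    eval P x ≈ x * eval Q x ×
    eval (deriv P) x * eval Q x - eval P x * eval (deriv Q) x
      ≈ μ * (eval Q x * eval Q x)

  -- (1:0) is fixed by the degree-n map P/Q with multiplier μ: in the
  -- coordinate u = 1/x the map is u ↦ 1/φ(1/u) = rev n Q (u) / rev n P (u),
  -- and 0 is a fixed point of it with multiplier μ.
  InfinityFixedWithMultiplier : ℕ → Poly → Poly → Carrier → Set ℓ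
  InfinityFixedWithMultiplier n P Q μ =
    AffineFixedWithMultiplier (rev n Q) (rev n P) 0# μ

  prodLinear : ∀ {m} → (Fin m → Carrier) → Poly
  prodLinear {zero}  xs = const 1#
  prodLinear {suc m} xs = (X -ₚ const (xs fzero)) *ₚ prodLinear (λ i → xs (fsuc i))

{-# OPTIONS --safe #-}
-- Write n = d - 1 and f = ∏ (x - xᵢ). Since (1:0) is fixed, deg Q < n, so P - xQ has degree at most n
-- and vanishes at the n points xᵢ; hence P = xQ + c f, i.e. φ(x) = x + c f(x)/Q(x). At a root xᵢ of f
-- such a map has multiplier 1 + c f'(xᵢ)/Q(xᵢ), so multiplier 1 - r at every xᵢ says that c f' + r Q,
-- a polynomial of degree below n, vanishes at all xᵢ; thus c f' = -r Q, and P f' = xQ f' + f · c f'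
-- = Q (x f' - r f). Characteristic 0 turns the pointwise identities into identities of polynomials.
module Submission where

open import Defs
open import Level using (Level)
open import Data.Nat as ℕ using (ℕ; zero; suc; _≤_; _∸_; s≤s)
import Data.Nat.Properties as ℕₚ
open import Data.Integer using (ℤ; +_; -[1+_])
import Data.Integer as ℤ
import Data.Integer.Properties as ℤₚ
open import Data.Sign as Sign using (Sign)
open import Data.Fin using (Fin; toℕ) renaming (zero to fzero; suc to fsuc)
import Data.Fin.Properties as Finₚ
open import Data.List using ([]; _∷_; length)
open import Data.Maybe using (Maybe; just; nothing)
open import Data.Product using (∃; _,_; proj₁; proj₂; _×_)
open import Relation.Nullary using (¬_; yes; no)
open import Relation.Binary.PropositionalEquality using (_≡_; _≢_; cong) renaming (sym to ≡-sym; refl to ≡-refl)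
import Algebra.Solver.Ring
import Algebra.Solver.Ring.AlmostCommutativeRing as ACR
import Algebra.Properties.Group as GroupProperties
import Algebra.Properties.AbelianGroup as AbelianGroupProperties
import Algebra.Properties.Ring as RingProperties

module _ {o ℓ : Level} (F : Field o ℓ) where
  open Field F hiding (zero)
  open FieldDefs F
  open GroupProperties +-group using (⁻¹-involutive; ε⁻¹≈ε; x∙y⁻¹≈ε⇒x≈y; ⁻¹-anti-homo-∙)
  open AbelianGroupProperties +-abelianGroup using (xyx⁻¹≈y)
  open RingProperties ring using (-‿distribˡ-*; -‿distribʳ-*; +-cancelˡ; [y-z]x≈yx-zx)
  open import Relation.Binary.Reasoning.Setoid setoid

  natK-homo-+ : ∀ m n → natK (m ℕ.+ n) ≈ natK m + natK n
  natK-homo-+ zero    n = sym (+-identityˡ _)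
  natK-homo-+ (suc m) n = trans (+-congˡ (natK-homo-+ m n)) (sym (+-assoc _ _ _))

  natK-homo-* : ∀ m n → natK (m ℕ.* n) ≈ natK m * natK n
  natK-homo-* zero    n = sym (zeroˡ _)
  natK-homo-* (suc m) n = begin
    natK (n ℕ.+ m ℕ.* n)          ≈⟨ natK-homo-+ n (m ℕ.* n) ⟩
    natK n + natK (m ℕ.* n)       ≈⟨ +-cong (sym (*-identityˡ _)) (natK-homo-* m n) ⟩
    1# * natK n + natK m * natK n ≈⟨ distribʳ _ _ _ ⟨
    natK (suc m) * natK n         ∎

  signK : Sign → Carrier → Carrier
  signK Sign.+ a = a
  signK Sign.- a = - a

  signK-cong : ∀ s {a b} → a ≈ b → signK s a ≈ signK s b
  signK-cong Sign.+ a≈b = a≈b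
  signK-cong Sign.- a≈b = -‿cong a≈b

  signK-* : ∀ s t a b → signK (s Sign.* t) (a * b) ≈ signK s a * signK t b
  signK-* Sign.+ Sign.+ a b = refl
  signK-* Sign.+ Sign.- a b = -‿distribʳ-* a b
  signK-* Sign.- Sign.+ a b = -‿distribˡ-* a b
  signK-* Sign.- Sign.- a b = begin
    a * b         ≈⟨ ⁻¹-involutive (a * b) ⟨
    - - (a * b)   ≈⟨ -‿cong (-‿distribˡ-* a b) ⟩
    - (- a * b)   ≈⟨ -‿distribʳ-* (- a) b ⟩
    - a * - b     ∎

  intK-◃ : ∀ s k → intK (s ℤ.◃ k) ≈ signK s (natK k)
  intK-◃ Sign.+ zero    = refl
  intK-◃ Sign.+ (suc k) = refl
  intK-◃ Sign.- zero    = sym ε⁻¹≈ε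
  intK-◃ Sign.- (suc k) = refl

  intK-sign-abs : ∀ i → intK i ≈ signK (ℤ.sign i) (natK ℤ.∣ i ∣)
  intK-sign-abs (+ n)    = refl
  intK-sign-abs -[1+ n ] = refl

  intK-homo-* : ∀ i j → intK (i ℤ.* j) ≈ intK i * intK j
  intK-homo-* i j = begin
    intK (s ℤ.◃ ℤ.∣ i ∣ ℕ.* ℤ.∣ j ∣)      ≈⟨ intK-◃ s (ℤ.∣ i ∣ ℕ.* ℤ.∣ j ∣) ⟩
    signK s (natK (ℤ.∣ i ∣ ℕ.* ℤ.∣ j ∣))   ≈⟨ signK-cong s (natK-homo-* ℤ.∣ i ∣ ℤ.∣ j ∣) ⟩
    signK s (natK ℤ.∣ i ∣ * natK ℤ.∣ j ∣)  ≈⟨ signK-* (ℤ.sign i) (ℤ.sign j) _ _ ⟩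
    signK (ℤ.sign i) (natK ℤ.∣ i ∣) * signK (ℤ.sign j) (natK ℤ.∣ j ∣)
      ≈⟨ *-cong (intK-sign-abs i) (intK-sign-abs j) ⟨
    intK i * intK j                        ∎
    where s = ℤ.sign i Sign.* ℤ.sign j

  intK-homo-neg : ∀ i → intK (ℤ.- i) ≈ - intK i
  intK-homo-neg (+ zero)  = sym ε⁻¹≈ε
  intK-homo-neg (+ suc n) = refl
  intK-homo-neg -[1+ n ]  = sym (⁻¹-involutive _)

  intK-homo-⊖ : ∀ m n → intK (m ℤ.⊖ n) ≈ natK m - natK n
  intK-homo-⊖ m       zero    = sym (trans (+-congˡ ε⁻¹≈ε) (+-identityʳ _))
  intK-homo-⊖ zero    (suc n) = sym (+-identityˡ _)
  intK-homo-⊖ (suc m) (suc n) = begin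
    intK (suc m ℤ.⊖ suc n)                 ≡⟨ cong intK (ℤₚ.[1+m]⊖[1+n]≡m⊖n m n) ⟩
    intK (m ℤ.⊖ n)                         ≈⟨ intK-homo-⊖ m n ⟩
    natK m - natK n                        ≈⟨ xyx⁻¹≈y 1# (natK m - natK n) ⟨
    (1# + (natK m - natK n)) - 1#          ≈⟨ +-congʳ (+-assoc 1# (natK m) _) ⟨
    ((1# + natK m) - natK n) - 1#          ≈⟨ +-assoc _ _ _ ⟩
    (1# + natK m) + (- natK n - 1#)        ≈⟨ +-congˡ (⁻¹-anti-homo-∙ 1# (natK n)) ⟨
    natK (suc m) - natK (suc n)            ∎

  intK-homo-+ : ∀ i j → intK (i ℤ.+ j) ≈ intK i + intK j
  intK-homo-+ (+ m)    (+ n)    = natK-homo-+ m n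
  intK-homo-+ (+ m)    -[1+ n ] = intK-homo-⊖ m (suc n)
  intK-homo-+ -[1+ m ] (+ n)    = trans (intK-homo-⊖ n (suc m)) (+-comm _ _)
  intK-homo-+ -[1+ m ] -[1+ n ] = begin
    - natK (suc (suc (m ℕ.+ n)))      ≡⟨ cong (λ k → - natK k) (ℕₚ.+-suc (suc m) n) ⟨
    - natK (suc m ℕ.+ suc n)          ≈⟨ -‿cong (natK-homo-+ (suc m) (suc n)) ⟩
    - (natK (suc m) + natK (suc n))   ≈⟨ ⁻¹-anti-homo-∙ _ _ ⟩
    - natK (suc n) + - natK (suc m)   ≈⟨ +-comm _ _ ⟩
    - natK (suc m) + - natK (suc n)   ∎

  intK-morphism : ℤ.+-*-rawRing ACR.-Raw-AlmostCommutative⟶ ACR.fromCommutativeRing commutativeRing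
  intK-morphism = record
    { ⟦_⟧    = intK
    ; +-homo = intK-homo-+
    ; *-homo = intK-homo-*
    ; -‿homo = intK-homo-neg
    ; 0-homo = refl
    ; 1-homo = +-identityʳ 1#
    }

  intK-≟ : ∀ i j → Maybe (intK i ≈ intK j)
  intK-≟ i j with i ℤ.≟ j
  ... | yes i≡j = just (reflexive (cong intK i≡j))
  ... | no  _   = nothing

  -- Integer rather than K-valued coefficients, so that the solver compares normal forms by computation.
  open Algebra.Solver.Ring ℤ.+-*-rawRing (ACR.fromCommutativeRing commutativeRing) intK-morphism intK-≟
    using (solve; _:=_; _:+_; _:*_; _:-_)

  x*y≈0⇒y≈0 : ∀ {x y} → ¬ (x ≈ 0#) → x * y ≈ 0# → y ≈ 0#
  x*y≈0⇒y≈0 {x} {y} x≉0 xy≈0 with inverse x x≉0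
  ... | x⁻¹ , xx⁻¹≈1 = begin
    y               ≈⟨ *-identityˡ y ⟨
    1# * y          ≈⟨ *-congʳ xx⁻¹≈1 ⟨
    (x * x⁻¹) * y   ≈⟨ *-congʳ (*-comm x x⁻¹) ⟩
    (x⁻¹ * x) * y   ≈⟨ *-assoc x⁻¹ x y ⟩
    x⁻¹ * (x * y)   ≈⟨ *-congˡ xy≈0 ⟩
    x⁻¹ * 0#        ≈⟨ zeroʳ x⁻¹ ⟩
    0#              ∎

  *-cancelʳ-nonzero : ∀ {z} a b → ¬ (z ≈ 0#) → a * z ≈ b * z → a ≈ b
  *-cancelʳ-nonzero {z} a b z≉0 az≈bz = x∙y⁻¹≈ε⇒x≈y a b (x*y≈0⇒y≈0 z≉0 (begin
    z * (a - b)        ≈⟨ *-comm z _ ⟩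
    (a - b) * z        ≈⟨ [y-z]x≈yx-zx z a b ⟩
    a * z - b * z      ≈⟨ +-congʳ az≈bz ⟩
    b * z - b * z      ≈⟨ -‿inverseʳ _ ⟩
    0#                 ∎))

  natK-injective : CharZero → ∀ m n → natK m ≈ natK n → m ≡ n
  natK-injective char0 zero    zero    _   = ≡-refl
  natK-injective char0 zero    (suc n) 0≈n with char0 (suc n) (sym 0≈n)
  ... | ()
  natK-injective char0 (suc m) zero    m≈0 with char0 (suc m) m≈0
  ... | ()
  natK-injective char0 (suc m) (suc n) 1+m≈1+n =
    cong suc (natK-injective char0 m n (+-cancelˡ 1# (natK m) (natK n) 1+m≈1+n))

  coeff-+ₚ : ∀ p q k → coeff (p +ₚ q) k ≈ coeff p k + coeff q k
  coeff-+ₚ []      q       k       = sym (+-identityˡ _)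
  coeff-+ₚ (a ∷ p) []      k       = sym (+-identityʳ _)
  coeff-+ₚ (a ∷ p) (b ∷ q) zero    = refl
  coeff-+ₚ (a ∷ p) (b ∷ q) (suc k) = coeff-+ₚ p q k

  coeff-negₚ : ∀ p k → coeff (-ₚ p) k ≈ - coeff p k
  coeff-negₚ []      k       = sym ε⁻¹≈ε
  coeff-negₚ (a ∷ p) zero    = refl
  coeff-negₚ (a ∷ p) (suc k) = coeff-negₚ p k

  coeff-scale : ∀ a p k → coeff (scale a p) k ≈ a * coeff p k
  coeff-scale a []      k       = sym (zeroʳ a)
  coeff-scale a (b ∷ p) zero    = refl
  coeff-scale a (b ∷ p) (suc k) = coeff-scale a p k

  coeff--ₚ : ∀ p q k → coeff (p -ₚ q) k ≈ coeff p k - coeff q k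
  coeff--ₚ p q k = trans (coeff-+ₚ p (-ₚ q) k) (+-congˡ (coeff-negₚ q k))

  coeff-∷*ₚ-suc : ∀ a p q k → coeff ((a ∷ p) *ₚ q) (suc k) ≈ a * coeff q (suc k) + coeff (p *ₚ q) k
  coeff-∷*ₚ-suc a p q k = trans (coeff-+ₚ (scale a q) _ (suc k)) (+-congʳ (coeff-scale a q (suc k)))

  coeff-X*ₚ-zero : ∀ q → coeff (X *ₚ q) zero ≈ 0#
  coeff-X*ₚ-zero q = begin
    coeff (X *ₚ q) zero         ≈⟨ coeff-+ₚ (scale 0# q) _ zero ⟩
    coeff (scale 0# q) zero + 0# ≈⟨ +-identityʳ _ ⟩
    coeff (scale 0# q) zero     ≈⟨ coeff-scale 0# q zero ⟩
    0# * coeff q zero           ≈⟨ zeroˡ _ ⟩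
    0#                          ∎

  coeff-const*ₚ : ∀ a q k → coeff (const a *ₚ q) k ≈ a * coeff q k
  coeff-const*ₚ a q k = begin
    coeff (scale a q +ₚ (0# ∷ [])) k         ≈⟨ coeff-+ₚ (scale a q) (0# ∷ []) k ⟩
    coeff (scale a q) k + coeff (0# ∷ []) k  ≈⟨ +-cong (coeff-scale a q k) (coeff-0# k) ⟩
    a * coeff q k + 0#                       ≈⟨ +-identityʳ _ ⟩
    a * coeff q k                            ∎
    where
    coeff-0# : ∀ k → coeff (0# ∷ []) k ≈ 0#
    coeff-0# zero    = refl
    coeff-0# (suc k) = refl

  coeff-X*ₚ-suc : ∀ q k → coeff (X *ₚ q) (suc k) ≈ coeff q k
  coeff-X*ₚ-suc q k = begin
    coeff (X *ₚ q) (suc k)                         ≈⟨ coeff-∷*ₚ-suc 0# (1# ∷ []) q k ⟩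
    0# * coeff q (suc k) + coeff (const 1# *ₚ q) k  ≈⟨ +-cong (zeroˡ _) (coeff-const*ₚ 1# q k) ⟩
    0# + 1# * coeff q k                            ≈⟨ +-identityˡ _ ⟩
    1# * coeff q k                                 ≈⟨ *-identityˡ _ ⟩
    coeff q k                                      ∎

  coeff-linear*ₚ-suc : ∀ a q k → coeff ((X -ₚ const a) *ₚ q) (suc k) ≈ coeff q k - a * coeff q (suc k)
  coeff-linear*ₚ-suc a q k = begin
    coeff ((X -ₚ const a) *ₚ q) (suc k)                        ≈⟨ coeff-∷*ₚ-suc (0# + - a) (1# ∷ []) q k ⟩
    (0# + - a) * coeff q (suc k) + coeff (const 1# *ₚ q) k      ≈⟨ +-cong (*-congʳ (+-identityˡ _)) (coeff-const*ₚ 1# q k) ⟩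
    - a * coeff q (suc k) + 1# * coeff q k                     ≈⟨ +-cong (sym (-‿distribˡ-* a _)) (*-identityˡ _) ⟩
    - (a * coeff q (suc k)) + coeff q k                        ≈⟨ +-comm _ _ ⟩
    coeff q k - a * coeff q (suc k)                            ∎

  eval-+ₚ : ∀ p q x → eval (p +ₚ q) x ≈ eval p x + eval q x
  eval-+ₚ []      q       x = sym (+-identityˡ _)
  eval-+ₚ (a ∷ p) []      x = sym (+-identityʳ _)
  eval-+ₚ (a ∷ p) (b ∷ q) x = begin
    (a + b) + x * eval (p +ₚ q) x            ≈⟨ +-congˡ (*-congˡ (eval-+ₚ p q x)) ⟩
    (a + b) + x * (eval p x + eval q x)      ≈⟨ solve 5 (λ a b x p q → (a :+ b) :+ x :* (p :+ q) := (a :+ x :* p) :+ (b :+ x :* q))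
                                                   refl a b x (eval p x) (eval q x) ⟩
    (a + x * eval p x) + (b + x * eval q x)  ∎

  eval-negₚ : ∀ p x → eval (-ₚ p) x ≈ - eval p x
  eval-negₚ []      x = sym ε⁻¹≈ε
  eval-negₚ (a ∷ p) x = begin
    - a + x * eval (-ₚ p) x      ≈⟨ +-congˡ (*-congˡ (eval-negₚ p x)) ⟩
    - a + x * - eval p x         ≈⟨ +-congˡ (-‿distribʳ-* x (eval p x)) ⟨
    - a + - (x * eval p x)       ≈⟨ +-comm _ _ ⟩
    - (x * eval p x) + - a       ≈⟨ ⁻¹-anti-homo-∙ a _ ⟨
    - (a + x * eval p x)         ∎

  eval--ₚ : ∀ p q x → eval (p -ₚ q) x ≈ eval p x - eval q x
  eval--ₚ p q x = trans (eval-+ₚ p (-ₚ q) x) (+-congˡ (eval-negₚ q x))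

  eval-scale : ∀ a p x → eval (scale a p) x ≈ a * eval p x
  eval-scale a []      x = sym (zeroʳ a)
  eval-scale a (b ∷ p) x = begin
    a * b + x * eval (scale a p) x  ≈⟨ +-congˡ (*-congˡ (eval-scale a p x)) ⟩
    a * b + x * (a * eval p x)      ≈⟨ solve 4 (λ a b x p → a :* b :+ x :* (a :* p) := a :* (b :+ x :* p)) refl a b x (eval p x) ⟩
    a * (b + x * eval p x)          ∎

  eval-*ₚ : ∀ p q x → eval (p *ₚ q) x ≈ eval p x * eval q x
  eval-*ₚ []      q x = sym (zeroˡ _)
  eval-*ₚ (a ∷ p) q x = begin
    eval (scale a q +ₚ (0# ∷ (p *ₚ q))) x            ≈⟨ eval-+ₚ (scale a q) (0# ∷ (p *ₚ q)) x ⟩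
    eval (scale a q) x + (0# + x * eval (p *ₚ q) x)  ≈⟨ +-cong (eval-scale a q x) (trans (+-identityˡ _) (*-congˡ (eval-*ₚ p q x))) ⟩
    a * eval q x + x * (eval p x * eval q x)         ≈⟨ solve 4 (λ a x p q → a :* q :+ x :* (p :* q) := (a :+ x :* p) :* q)
                                                          refl a x (eval p x) (eval q x) ⟩
    (a + x * eval p x) * eval q x                    ∎

  eval-const : ∀ a x → eval (const a) x ≈ a
  eval-const a x = trans (+-congˡ (zeroʳ x)) (+-identityʳ a)

  eval-X : ∀ x → eval X x ≈ x
  eval-X x = begin
    0# + x * eval (const 1#) x  ≈⟨ +-identityˡ _ ⟩
    x * eval (const 1#) x       ≈⟨ *-congˡ (eval-const 1# x) ⟩
    x * 1#                      ≈⟨ *-identityʳ x ⟩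
    x                           ∎

  eval-X*ₚ : ∀ p x → eval (X *ₚ p) x ≈ x * eval p x
  eval-X*ₚ p x = trans (eval-*ₚ X p x) (*-congʳ (eval-X x))

  eval-≈ₚ[] : ∀ p x → p ≈ₚ [] → eval p x ≈ 0#
  eval-≈ₚ[] []      x _   = refl
  eval-≈ₚ[] (a ∷ p) x p≈0 = begin
    a + x * eval p x  ≈⟨ +-cong (p≈0 zero) (*-congˡ (eval-≈ₚ[] p x (λ k → p≈0 (suc k)))) ⟩
    0# + x * 0#       ≈⟨ +-identityˡ _ ⟩
    x * 0#            ≈⟨ zeroʳ x ⟩
    0#                ∎

  eval-cong : ∀ p q x → p ≈ₚ q → eval p x ≈ eval q x
  eval-cong []      q       x p≈q = sym (eval-≈ₚ[] q x (λ k → sym (p≈q k)))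
  eval-cong (a ∷ p) []      x p≈q = eval-≈ₚ[] (a ∷ p) x p≈q
  eval-cong (a ∷ p) (b ∷ q) x p≈q = +-cong (p≈q zero) (*-congˡ (eval-cong p q x (λ k → p≈q (suc k))))

  -- Phrased with n + k rather than n ≤ k so that DegLessThan (a ∷ p) (suc n) is DegLessThan p n by computation.
  DegLessThan : Poly → ℕ → Set ℓ
  DegLessThan p n = ∀ k → coeff p (n ℕ.+ k) ≈ 0#

  DegAtMost⇒DegLessThan : ∀ p n → DegAtMost p n → DegLessThan p (suc n)
  DegAtMost⇒DegLessThan p n deg k = deg (suc n ℕ.+ k) (s≤s (ℕₚ.m≤m+n n k))

  DegLessThan-suc : ∀ p n → DegLessThan p n → DegLessThan p (suc n)
  DegLessThan-suc p n deg k = trans (sym (reflexive (cong (coeff p) (ℕₚ.+-suc n k)))) (deg (suc k))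

  DegLessThan-pred : ∀ p n → DegLessThan p (suc n) → coeff p n ≈ 0# → DegLessThan p n
  DegLessThan-pred p n deg pₙ≈0 zero    = trans (reflexive (cong (coeff p) (ℕₚ.+-identityʳ n))) pₙ≈0
  DegLessThan-pred p n deg pₙ≈0 (suc k) = trans (reflexive (cong (coeff p) (ℕₚ.+-suc n k))) (deg k)

  DegLessThan-length : ∀ p → DegLessThan p (length p)
  DegLessThan-length []      k = refl
  DegLessThan-length (a ∷ p) k = DegLessThan-length p k

  DegLessThan⇒coeff≈0 : ∀ p n {k} → DegLessThan p n → n ≤ k → coeff p k ≈ 0#
  DegLessThan⇒coeff≈0 p n {k} deg n≤k =
    trans (sym (reflexive (cong (coeff p) (ℕₚ.m+[n∸m]≡n n≤k)))) (deg (k ∸ n))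

  DegLessThan-+ₚ : ∀ p q n → DegLessThan p n → DegLessThan q n → DegLessThan (p +ₚ q) n
  DegLessThan-+ₚ p q n degp degq k = begin
    coeff (p +ₚ q) (n ℕ.+ k)                  ≈⟨ coeff-+ₚ p q (n ℕ.+ k) ⟩
    coeff p (n ℕ.+ k) + coeff q (n ℕ.+ k)     ≈⟨ +-cong (degp k) (degq k) ⟩
    0# + 0#                                   ≈⟨ +-identityˡ 0# ⟩
    0#                                        ∎

  DegLessThan--ₚ : ∀ p q n → DegLessThan p n → DegLessThan q n → DegLessThan (p -ₚ q) n
  DegLessThan--ₚ p q n degp degq k = begin
    coeff (p -ₚ q) (n ℕ.+ k)                  ≈⟨ coeff--ₚ p q (n ℕ.+ k) ⟩
    coeff p (n ℕ.+ k) - coeff q (n ℕ.+ k)     ≈⟨ +-cong (degp k) (-‿cong (degq k)) ⟩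
    0# - 0#                                   ≈⟨ -‿inverseʳ 0# ⟩
    0#                                        ∎

  DegLessThan-scale : ∀ a p n → DegLessThan p n → DegLessThan (scale a p) n
  DegLessThan-scale a p n deg k = trans (coeff-scale a p (n ℕ.+ k)) (trans (*-congˡ (deg k)) (zeroʳ a))

  DegLessThan-X*ₚ : ∀ q n → DegLessThan q n → DegLessThan (X *ₚ q) (suc n)
  DegLessThan-X*ₚ q n deg k = trans (coeff-X*ₚ-suc q (n ℕ.+ k)) (deg k)

  quotient : Carrier → Poly → Poly
  quotient a []      = []
  quotient a (b ∷ p) = eval p a ∷ quotient a p

  eval-quotient : ∀ a p x → eval p x ≈ (x - a) * eval (quotient a p) x + eval p a
  eval-quotient a []      x = sym (trans (+-identityʳ _) (zeroʳ _))
  eval-quotient a (b ∷ p) x = begin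
    b + x * eval p x                                 ≈⟨ +-congˡ (*-congˡ (eval-quotient a p x)) ⟩
    b + x * ((x - a) * eval (quotient a p) x + pa)   ≈⟨ solve 5 (λ b x a q pa → b :+ x :* ((x :- a) :* q :+ pa)
                                                                 := (x :- a) :* (pa :+ x :* q) :+ (b :+ a :* pa))
                                                          refl b x a (eval (quotient a p) x) pa ⟩
    (x - a) * (pa + x * eval (quotient a p) x) + (b + a * pa) ∎
    where pa = eval p a

  DegLessThan-quotient : ∀ a p n → DegLessThan p (suc n) → DegLessThan (quotient a p) n
  DegLessThan-quotient a []      n       deg k       = refl
  DegLessThan-quotient a (b ∷ p) zero    deg zero    = eval-≈ₚ[] p a deg
  DegLessThan-quotient a (b ∷ p) zero    deg (suc k) = DegLessThan-quotient a p zero (DegLessThan-suc p zero deg) k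
  DegLessThan-quotient a (b ∷ p) (suc n) deg k       = DegLessThan-quotient a p n deg k

  quotient≈ₚ[]⇒≈ₚ[] : ∀ a p → eval p a ≈ 0# → quotient a p ≈ₚ [] → p ≈ₚ []
  quotient≈ₚ[]⇒≈ₚ[] a []      _    _    k       = refl
  quotient≈ₚ[]⇒≈ₚ[] a (b ∷ p) pa≈0 q≈0 zero    = begin
    b                 ≈⟨ +-identityʳ b ⟨
    b + 0#            ≈⟨ +-congˡ (zeroʳ a) ⟨
    b + a * 0#        ≈⟨ +-congˡ (*-congˡ (q≈0 zero)) ⟨
    b + a * eval p a  ≈⟨ pa≈0 ⟩
    0#                ∎
  quotient≈ₚ[]⇒≈ₚ[] a (b ∷ p) _    q≈0 (suc k) = quotient≈ₚ[]⇒≈ₚ[] a p (q≈0 zero) (λ j → q≈0 (suc j)) k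

  Distinct : ∀ {n} → (Fin n → Carrier) → Set ℓ
  Distinct xs = ∀ i j → i ≢ j → ¬ (xs i ≈ xs j)

  roots⇒≈ₚ[] : ∀ n p (xs : Fin n → Carrier) → Distinct xs → DegLessThan p n →
               (∀ i → eval p (xs i) ≈ 0#) → p ≈ₚ []
  roots⇒≈ₚ[] zero    p xs _        deg _     = deg
  roots⇒≈ₚ[] (suc n) p xs distinct deg roots =
    quotient≈ₚ[]⇒≈ₚ[] a p (roots fzero)
      (roots⇒≈ₚ[] n (quotient a p) (λ i → xs (fsuc i)) distinct-tail (DegLessThan-quotient a p n deg) quotient-roots)
    where
    a = xs fzero
    distinct-tail : Distinct (λ i → xs (fsuc i))
    distinct-tail i j i≢j = distinct (fsuc i) (fsuc j) (λ e → i≢j (Finₚ.suc-injective e))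
    quotient-roots : ∀ i → eval (quotient a p) (xs (fsuc i)) ≈ 0#
    quotient-roots i = x*y≈0⇒y≈0 y-a≉0 (begin
      (y - a) * eval (quotient a p) y              ≈⟨ +-identityʳ _ ⟨
      (y - a) * eval (quotient a p) y + 0#         ≈⟨ +-congˡ (roots fzero) ⟨
      (y - a) * eval (quotient a p) y + eval p a   ≈⟨ eval-quotient a p y ⟨
      eval p y                                     ≈⟨ roots (fsuc i) ⟩
      0#                                           ∎)
      where
      y = xs (fsuc i)
      y-a≉0 : ¬ (y - a ≈ 0#)
      y-a≉0 y-a≈0 = distinct (fsuc i) fzero (λ ()) (x∙y⁻¹≈ε⇒x≈y y a y-a≈0)

  eval-injective : CharZero → ∀ p q → (∀ x → eval p x ≈ eval q x) → p ≈ₚ q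
  eval-injective char0 p q p≗q k = x∙y⁻¹≈ε⇒x≈y _ _ (begin
    coeff p k - coeff q k  ≈⟨ coeff--ₚ p q k ⟨
    coeff (p -ₚ q) k       ≈⟨ roots⇒≈ₚ[] (length (p -ₚ q)) (p -ₚ q) points points-distinct
                                (DegLessThan-length (p -ₚ q)) roots k ⟩
    0#                     ∎)
    where
    points : Fin (length (p -ₚ q)) → Carrier
    points i = natK (toℕ i)
    points-distinct : Distinct points
    points-distinct i j i≢j e = i≢j (Finₚ.toℕ-injective (natK-injective char0 _ _ e))
    roots : ∀ i → eval (p -ₚ q) (points i) ≈ 0#
    roots i = trans (eval--ₚ p q (points i)) (trans (+-congʳ (p≗q (points i))) (-‿inverseʳ _))

  DegLessThan-linear*ₚ : ∀ a q n → DegLessThan q n → DegLessThan ((X -ₚ const a) *ₚ q) (suc n)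
  DegLessThan-linear*ₚ a q n deg k = begin
    coeff ((X -ₚ const a) *ₚ q) (suc (n ℕ.+ k))         ≈⟨ coeff-linear*ₚ-suc a q (n ℕ.+ k) ⟩
    coeff q (n ℕ.+ k) - a * coeff q (suc (n ℕ.+ k))     ≈⟨ +-cong (deg k) (-‿cong (*-congˡ (DegLessThan-suc q n deg k))) ⟩
    0# - a * 0#                                         ≈⟨ +-congˡ (-‿cong (zeroʳ a)) ⟩
    0# - 0#                                             ≈⟨ -‿inverseʳ 0# ⟩
    0#                                                  ∎

  coeff-linear*ₚ-leading : ∀ a q n → DegLessThan q (suc n) → coeff ((X -ₚ const a) *ₚ q) (suc n) ≈ coeff q n
  coeff-linear*ₚ-leading a q n deg = begin
    coeff ((X -ₚ const a) *ₚ q) (suc n)   ≈⟨ coeff-linear*ₚ-suc a q n ⟩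
    coeff q n - a * coeff q (suc n)       ≈⟨ +-congˡ (-‿cong (*-congˡ (DegLessThan⇒coeff≈0 q (suc n) deg ℕₚ.≤-refl))) ⟩
    coeff q n - a * 0#                    ≈⟨ +-congˡ (trans (-‿cong (zeroʳ a)) ε⁻¹≈ε) ⟩
    coeff q n + 0#                        ≈⟨ +-identityʳ _ ⟩
    coeff q n                             ∎

  eval-linear : ∀ a x → eval (X -ₚ const a) x ≈ x - a
  eval-linear a x = trans (eval--ₚ X (const a) x) (+-cong (eval-X x) (-‿cong (eval-const a x)))

  prodLinear-monic : ∀ m (xs : Fin m → Carrier) →
                     DegLessThan (prodLinear xs) (suc m) × coeff (prodLinear xs) m ≈ 1#
  prodLinear-monic zero    xs = (λ k → refl) , refl
  prodLinear-monic (suc m) xs =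
    DegLessThan-linear*ₚ (xs fzero) (prodLinear rest) (suc m) (proj₁ rest-monic) ,
    trans (coeff-linear*ₚ-leading (xs fzero) (prodLinear rest) m (proj₁ rest-monic)) (proj₂ rest-monic)
    where
    rest : Fin m → Carrier
    rest i = xs (fsuc i)
    rest-monic = prodLinear-monic m rest

  prodLinear-roots : ∀ m (xs : Fin m → Carrier) i → eval (prodLinear xs) (xs i) ≈ 0#
  prodLinear-roots (suc m) xs i = begin
    eval (prodLinear xs) (xs i)                          ≈⟨ eval-*ₚ (X -ₚ const (xs fzero)) (prodLinear rest) (xs i) ⟩
    eval (X -ₚ const (xs fzero)) (xs i) * eval (prodLinear rest) (xs i)
                                                         ≈⟨ *-congʳ (eval-linear (xs fzero) (xs i)) ⟩
    (xs i - xs fzero) * eval (prodLinear rest) (xs i)    ≈⟨ some-factor-vanishes i ⟩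
    0#                                                   ∎
    where
    rest : Fin m → Carrier
    rest j = xs (fsuc j)
    some-factor-vanishes : ∀ i → (xs i - xs fzero) * eval (prodLinear rest) (xs i) ≈ 0#
    some-factor-vanishes fzero    = trans (*-congʳ (-‿inverseʳ _)) (zeroˡ _)
    some-factor-vanishes (fsuc i) = trans (*-congˡ (prodLinear-roots m rest i)) (zeroʳ _)

  coeff-derivFrom : ∀ n p k → coeff (derivFrom n p) k ≈ natK (n ℕ.+ k) * coeff p k
  coeff-derivFrom n []      k       = sym (zeroʳ _)
  coeff-derivFrom n (b ∷ p) zero    = *-congʳ (reflexive (cong natK (≡-sym (ℕₚ.+-identityʳ n))))
  coeff-derivFrom n (b ∷ p) (suc k) = trans (coeff-derivFrom (suc n) p k) (*-congʳ (reflexive (cong natK (≡-sym (ℕₚ.+-suc n k)))))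

  coeff-deriv : ∀ p k → coeff (deriv p) k ≈ natK (suc k) * coeff p (suc k)
  coeff-deriv []      k = sym (zeroʳ _)
  coeff-deriv (a ∷ p) k = coeff-derivFrom 1 p k

  DegLessThan-deriv : ∀ p n → DegLessThan p (suc n) → DegLessThan (deriv p) n
  DegLessThan-deriv p n deg k = trans (coeff-deriv p (n ℕ.+ k)) (trans (*-congˡ (deg k)) (zeroʳ _))

  deriv-cong : ∀ p q → p ≈ₚ q → deriv p ≈ₚ deriv q
  deriv-cong p q p≈q k = trans (coeff-deriv p k) (trans (*-congˡ (p≈q (suc k))) (sym (coeff-deriv q k)))

  deriv-+ₚ : ∀ p q → deriv (p +ₚ q) ≈ₚ deriv p +ₚ deriv q
  deriv-+ₚ p q k = begin
    coeff (deriv (p +ₚ q)) k                                           ≈⟨ coeff-deriv (p +ₚ q) k ⟩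
    natK (suc k) * coeff (p +ₚ q) (suc k)                              ≈⟨ *-congˡ (coeff-+ₚ p q (suc k)) ⟩
    natK (suc k) * (coeff p (suc k) + coeff q (suc k))                 ≈⟨ distribˡ _ _ _ ⟩
    natK (suc k) * coeff p (suc k) + natK (suc k) * coeff q (suc k)    ≈⟨ +-cong (coeff-deriv p k) (coeff-deriv q k) ⟨
    coeff (deriv p) k + coeff (deriv q) k                              ≈⟨ coeff-+ₚ (deriv p) (deriv q) k ⟨
    coeff (deriv p +ₚ deriv q) k                                       ∎

  deriv-scale : ∀ a p → deriv (scale a p) ≈ₚ scale a (deriv p)
  deriv-scale a p k = begin
    coeff (deriv (scale a p)) k            ≈⟨ coeff-deriv (scale a p) k ⟩
    natK (suc k) * coeff (scale a p) (suc k) ≈⟨ *-congˡ (coeff-scale a p (suc k)) ⟩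
    natK (suc k) * (a * coeff p (suc k))   ≈⟨ solve 3 (λ n a c → n :* (a :* c) := a :* (n :* c)) refl (natK (suc k)) a _ ⟩
    a * (natK (suc k) * coeff p (suc k))   ≈⟨ *-congˡ (coeff-deriv p k) ⟨
    a * coeff (deriv p) k                  ≈⟨ coeff-scale a (deriv p) k ⟨
    coeff (scale a (deriv p)) k            ∎

  deriv-X*ₚ : ∀ q → deriv (X *ₚ q) ≈ₚ q +ₚ X *ₚ deriv q
  deriv-X*ₚ q k = begin
    coeff (deriv (X *ₚ q)) k                  ≈⟨ coeff-deriv (X *ₚ q) k ⟩
    (1# + natK k) * coeff (X *ₚ q) (suc k)    ≈⟨ *-congˡ (coeff-X*ₚ-suc q k) ⟩
    (1# + natK k) * coeff q k                 ≈⟨ distribʳ _ _ _ ⟩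
    1# * coeff q k + natK k * coeff q k       ≈⟨ +-cong (*-identityˡ _) (sym (coeff-X*ₚ-deriv k)) ⟩
    coeff q k + coeff (X *ₚ deriv q) k        ≈⟨ coeff-+ₚ q (X *ₚ deriv q) k ⟨
    coeff (q +ₚ X *ₚ deriv q) k               ∎
    where
    coeff-X*ₚ-deriv : ∀ k → coeff (X *ₚ deriv q) k ≈ natK k * coeff q k
    coeff-X*ₚ-deriv zero    = trans (coeff-X*ₚ-zero (deriv q)) (sym (zeroˡ _))
    coeff-X*ₚ-deriv (suc k) = trans (coeff-X*ₚ-suc (deriv q) k) (coeff-deriv q k)

  vanishing⇒prodLinear-multiple : ∀ n (xs : Fin n → Carrier) → Distinct xs →
    ∀ h → DegLessThan h (suc n) → (∀ i → eval h (xs i) ≈ 0#) →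
    ∀ x → eval h x ≈ coeff h n * eval (prodLinear xs) x
  vanishing⇒prodLinear-multiple n xs distinct h deg roots x =
    x∙y⁻¹≈ε⇒x≈y _ _ (trans (sym (eval-remainder x)) (eval-≈ₚ[] remainder x remainder≈0))
    where
    f = prodLinear xs
    c = coeff h n
    remainder = h -ₚ scale c f
    eval-remainder : ∀ x → eval remainder x ≈ eval h x - c * eval f x
    eval-remainder x = trans (eval--ₚ h (scale c f) x) (+-congˡ (-‿cong (eval-scale c f x)))
    leading-cancels : coeff remainder n ≈ 0#
    leading-cancels = begin
      coeff remainder n              ≈⟨ coeff--ₚ h (scale c f) n ⟩
      c - coeff (scale c f) n        ≈⟨ +-congˡ (-‿cong (trans (coeff-scale c f n) (*-congˡ (proj₂ (prodLinear-monic n xs))))) ⟩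
      c - c * 1#                     ≈⟨ +-congˡ (-‿cong (*-identityʳ c)) ⟩
      c - c                          ≈⟨ -‿inverseʳ c ⟩
      0#                             ∎
    remainder-deg : DegLessThan remainder n
    remainder-deg = DegLessThan-pred remainder n
      (DegLessThan--ₚ h (scale c f) (suc n) deg (DegLessThan-scale c f (suc n) (proj₁ (prodLinear-monic n xs))))
      leading-cancels
    remainder-roots : ∀ i → eval remainder (xs i) ≈ 0#
    remainder-roots i = begin
      eval remainder (xs i)                 ≈⟨ eval-remainder (xs i) ⟩
      eval h (xs i) - c * eval f (xs i)     ≈⟨ +-cong (roots i) (-‿cong (*-congˡ (prodLinear-roots n xs i))) ⟩
      0# - c * 0#                           ≈⟨ +-congˡ (-‿cong (zeroʳ c)) ⟩
      0# - 0#                               ≈⟨ -‿inverseʳ 0# ⟩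
      0#                                    ∎
    remainder≈0 = roots⇒≈ₚ[] n remainder xs distinct remainder-deg remainder-roots

  multiplier-at-root : ∀ P Q c f x → P ≈ₚ X *ₚ Q +ₚ scale c f → eval f x ≈ 0# →
    eval (deriv P) x * eval Q x - eval P x * eval (deriv Q) x
      ≈ (eval Q x + c * eval (deriv f) x) * eval Q x
  multiplier-at-root P Q c f x P≈ fx≈0 = begin
    eval (deriv P) x * q - eval P x * q'          ≈⟨ +-cong (*-congʳ eval-P′) (-‿cong (*-congʳ eval-P)) ⟩
    (q + (x * q' + c * φ)) * q - (x * q) * q'      ≈⟨ solve 5 (λ q q' x c φ → (q :+ (x :* q' :+ c :* φ)) :* q :- (x :* q) :* q'
                                                                 := (q :+ c :* φ) :* q) refl q q' x c φ ⟩
    (q + c * φ) * q                                ∎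
    where
    q  = eval Q x
    q' = eval (deriv Q) x
    φ  = eval (deriv f) x
    eval-P : eval P x ≈ x * q
    eval-P = begin
      eval P x                                  ≈⟨ eval-cong P (X *ₚ Q +ₚ scale c f) x P≈ ⟩
      eval (X *ₚ Q +ₚ scale c f) x              ≈⟨ eval-+ₚ (X *ₚ Q) (scale c f) x ⟩
      eval (X *ₚ Q) x + eval (scale c f) x      ≈⟨ +-cong (eval-X*ₚ Q x) (eval-scale c f x) ⟩
      x * q + c * eval f x                      ≈⟨ +-congˡ (trans (*-congˡ fx≈0) (zeroʳ c)) ⟩
      x * q + 0#                                ≈⟨ +-identityʳ _ ⟩
      x * q                                     ∎
    eval-P′ : eval (deriv P) x ≈ q + (x * q' + c * φ)
    eval-P′ = begin
      eval (deriv P) x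
        ≈⟨ eval-cong (deriv P) (deriv (X *ₚ Q +ₚ scale c f)) x (deriv-cong P (X *ₚ Q +ₚ scale c f) P≈) ⟩
      eval (deriv (X *ₚ Q +ₚ scale c f)) x
        ≈⟨ eval-cong (deriv (X *ₚ Q +ₚ scale c f)) (deriv (X *ₚ Q) +ₚ deriv (scale c f)) x
                     (deriv-+ₚ (X *ₚ Q) (scale c f)) ⟩
      eval (deriv (X *ₚ Q) +ₚ deriv (scale c f)) x
        ≈⟨ eval-+ₚ (deriv (X *ₚ Q)) (deriv (scale c f)) x ⟩
      eval (deriv (X *ₚ Q)) x + eval (deriv (scale c f)) x
        ≈⟨ +-cong (eval-cong (deriv (X *ₚ Q)) (Q +ₚ X *ₚ deriv Q) x (deriv-X*ₚ Q))
                  (eval-cong (deriv (scale c f)) (scale c (deriv f)) x (deriv-scale c f)) ⟩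
      eval (Q +ₚ X *ₚ deriv Q) x + eval (scale c (deriv f)) x
        ≈⟨ +-cong (trans (eval-+ₚ Q (X *ₚ deriv Q) x) (+-congˡ (eval-X*ₚ (deriv Q) x))) (eval-scale c (deriv f) x) ⟩
      (q + x * q') + c * φ
        ≈⟨ +-assoc q _ _ ⟩
      q + (x * q' + c * φ)
        ∎

  fixed-points⇒numerator-form : CharZero → ∀ n P Q (xs : Fin n → Carrier) → Distinct xs →
    DegAtMost P n → DegLessThan Q n → (∀ i → eval P (xs i) ≈ xs i * eval Q (xs i)) →
    ∃ λ c → P ≈ₚ X *ₚ Q +ₚ scale c (prodLinear xs)
  fixed-points⇒numerator-form char0 n P Q xs distinct degP degQ fixed =
    c , eval-injective char0 P (X *ₚ Q +ₚ scale c f) eval-P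
    where
    f = prodLinear xs
    h = P -ₚ X *ₚ Q
    c = coeff h n
    eval-h : ∀ x → eval h x ≈ eval P x - x * eval Q x
    eval-h x = trans (eval--ₚ P (X *ₚ Q) x) (+-congˡ (-‿cong (eval-X*ₚ Q x)))
    h-deg : DegLessThan h (suc n)
    h-deg = DegLessThan--ₚ P (X *ₚ Q) (suc n) (DegAtMost⇒DegLessThan P n degP) (DegLessThan-X*ₚ Q n degQ)
    h-roots : ∀ i → eval h (xs i) ≈ 0#
    h-roots i = trans (eval-h (xs i)) (trans (+-congʳ (fixed i)) (-‿inverseʳ _))
    eval-P : ∀ x → eval P x ≈ eval (X *ₚ Q +ₚ scale c f) x
    eval-P x = begin
      eval P x                                     ≈⟨ solve 2 (λ p xq → p := xq :+ (p :- xq)) refl (eval P x) (x * eval Q x) ⟩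
      x * eval Q x + (eval P x - x * eval Q x)     ≈⟨ +-congˡ (trans (sym (eval-h x)) (vanishing⇒prodLinear-multiple n xs distinct h h-deg h-roots x)) ⟩
      x * eval Q x + c * eval f x                  ≈⟨ +-cong (eval-X*ₚ Q x) (eval-scale c f x) ⟨
      eval (X *ₚ Q) x + eval (scale c f) x         ≈⟨ eval-+ₚ (X *ₚ Q) (scale c f) x ⟨
      eval (X *ₚ Q +ₚ scale c f) x                 ∎

  fixed-with-multiplier-1-R⇒c*f′+R*Q≈0 : ∀ n R P Q c (xs : Fin n → Carrier) → Distinct xs → DegLessThan Q n →
    P ≈ₚ X *ₚ Q +ₚ scale c (prodLinear xs) →
    (∀ i → AffineFixedWithMultiplier P Q (xs i) (1# - R)) →
    ∀ x → c * eval (deriv (prodLinear xs)) x + R * eval Q x ≈ 0#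
  fixed-with-multiplier-1-R⇒c*f′+R*Q≈0 n R P Q c xs distinct degQ P≈ fixed x =
    trans (sym (eval-s x)) (eval-≈ₚ[] s x (roots⇒≈ₚ[] n s xs distinct s-deg s-roots))
    where
    f′ = deriv (prodLinear xs)
    s = scale c f′ +ₚ scale R Q
    eval-s : ∀ x → eval s x ≈ c * eval f′ x + R * eval Q x
    eval-s x = trans (eval-+ₚ (scale c f′) (scale R Q) x) (+-cong (eval-scale c f′ x) (eval-scale R Q x))
    s-deg : DegLessThan s n
    s-deg = DegLessThan-+ₚ (scale c f′) (scale R Q) n
      (DegLessThan-scale c f′ n (DegLessThan-deriv (prodLinear xs) n (proj₁ (prodLinear-monic n xs))))
      (DegLessThan-scale R Q n degQ)
    s-roots : ∀ i → eval s (xs i) ≈ 0#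
    s-roots i with fixed i
    ... | q≉0 , _ , multiplier = trans (eval-s (xs i)) (begin
      c * φ + R * q                     ≈⟨ solve 4 (λ q c φ r → c :* φ :+ r :* q := (q :+ c :* φ) :- (q :- r :* q)) refl q c φ R ⟩
      (q + c * φ) - (q - R * q)         ≈⟨ +-cong q+cφ≈[1-R]q (-‿cong (+-congʳ (sym (*-identityˡ q)))) ⟩
      (1# - R) * q - (1# * q - R * q)   ≈⟨ +-congˡ (-‿cong ([y-z]x≈yx-zx q 1# R)) ⟨
      (1# - R) * q - (1# - R) * q       ≈⟨ -‿inverseʳ _ ⟩
      0#                                ∎)
      where
      q = eval Q (xs i)
      φ = eval f′ (xs i)
      q+cφ≈[1-R]q : q + c * φ ≈ (1# - R) * q
      q+cφ≈[1-R]q = *-cancelʳ-nonzero (q + c * φ) ((1# - R) * q) q≉0 (begin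
        (q + c * φ) * q
          ≈⟨ multiplier-at-root P Q c (prodLinear xs) (xs i) P≈ (prodLinear-roots n xs i) ⟨
        eval (deriv P) (xs i) * q - eval P (xs i) * eval (deriv Q) (xs i)
          ≈⟨ multiplier ⟩
        (1# - R) * (q * q)
          ≈⟨ *-assoc _ q q ⟨
        (1# - R) * q * q
          ∎)

  eval-rev-0# : ∀ n p → eval (rev n p) 0# ≈ coeff p n
  eval-rev-0# n p = trans (+-congˡ (zeroˡ _)) (+-identityʳ _)

  ∞-fixed⇒leading-coeff≈0 : ∀ n P Q μ → InfinityFixedWithMultiplier n P Q μ → coeff Q n ≈ 0#
  ∞-fixed⇒leading-coeff≈0 n P Q μ (_ , ∞-fixed , _) =
    trans (sym (eval-rev-0# n Q)) (trans ∞-fixed (zeroˡ _))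

  fixed-with-multiplier-1-R⇒relaxed-Newton : CharZero → ∀ n R P Q → DegAtMost P n → DegLessThan Q n →
    (xs : Fin n → Carrier) → Distinct xs → (∀ i → AffineFixedWithMultiplier P Q (xs i) (1# - R)) →
    P *ₚ deriv (prodLinear xs) ≈ₚ Q *ₚ (X *ₚ deriv (prodLinear xs) -ₚ const R *ₚ prodLinear xs)
  fixed-with-multiplier-1-R⇒relaxed-Newton char0 n R P Q degP degQ xs distinct fixed =
    eval-injective char0 (P *ₚ f′) (Q *ₚ (X *ₚ f′ -ₚ const R *ₚ f)) pointwise
    where
    f  = prodLinear xs
    f′ = deriv f
    numerator-form = fixed-points⇒numerator-form char0 n P Q xs distinct degP degQ (λ i → proj₁ (proj₂ (fixed i)))
    c  = proj₁ numerator-form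
    P≈ = proj₂ numerator-form
    c*f′+R*Q≈0 = fixed-with-multiplier-1-R⇒c*f′+R*Q≈0 n R P Q c xs distinct degQ P≈ fixed
    pointwise : ∀ x → eval (P *ₚ f′) x ≈ eval (Q *ₚ (X *ₚ f′ -ₚ const R *ₚ f)) x
    pointwise x = begin
      eval (P *ₚ f′) x                                ≈⟨ eval-*ₚ P f′ x ⟩
      eval P x * φ                                    ≈⟨ *-congʳ (eval-cong P (X *ₚ Q +ₚ scale c f) x P≈) ⟩
      eval (X *ₚ Q +ₚ scale c f) x * φ
        ≈⟨ *-congʳ (trans (eval-+ₚ (X *ₚ Q) (scale c f) x) (+-cong (eval-X*ₚ Q x) (eval-scale c f x))) ⟩
      (x * q + c * fx) * φ
        ≈⟨ solve 6 (λ x q c fx φ r → (x :* q :+ c :* fx) :* φ := q :* (x :* φ :- r :* fx) :+ fx :* (c :* φ :+ r :* q))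
                   refl x q c fx φ R ⟩
      q * (x * φ - R * fx) + fx * (c * φ + R * q)     ≈⟨ +-congˡ (trans (*-congˡ (c*f′+R*Q≈0 x)) (zeroʳ fx)) ⟩
      q * (x * φ - R * fx) + 0#                       ≈⟨ +-identityʳ _ ⟩
      q * (x * φ - R * fx)
        ≈⟨ *-congˡ (+-cong (eval-X*ₚ f′ x) (-‿cong (trans (eval-*ₚ (const R) f x) (*-congʳ (eval-const R x))))) ⟨
      q * (eval (X *ₚ f′) x - eval (const R *ₚ f) x)  ≈⟨ *-congˡ (eval--ₚ (X *ₚ f′) (const R *ₚ f) x) ⟨
      q * eval (X *ₚ f′ -ₚ const R *ₚ f) x            ≈⟨ eval-*ₚ Q (X *ₚ f′ -ₚ const R *ₚ f) x ⟨
      eval (Q *ₚ (X *ₚ f′ -ₚ const R *ₚ f)) x         ∎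
      where
      q  = eval Q x
      φ  = eval f′ x
      fx = eval f x

mainTheorem8 : ∀ {c ℓ : Level} (F : Field c ℓ) →
    let open Field F in
    let open FieldDefs F in
    CharZero →
    (r : ℤ) → r ≢ + 0 →
    (d : ℕ) → 2 ≤ d → + (d ∸ 1) ≢ r →
    (P Q : Poly) → IsRationalMapOfDegree (d ∸ 1) P Q →
    (xs : Fin (d ∸ 1) → Carrier) →
    (∀ i j → i ≢ j → ¬ (xs i ≈ xs j)) →
    (∀ i → AffineFixedWithMultiplier P Q (xs i) (1# - intK r)) →
    (μ : Carrier) → μ * intK (+ (d ∸ 1) Data.Integer.- r) ≈ intK (+ (d ∸ 1)) →
    InfinityFixedWithMultiplier (d ∸ 1) P Q μ →
    P *ₚ deriv (prodLinear xs)
      ≈ₚ Q *ₚ (X *ₚ deriv (prodLinear xs) -ₚ const (intK r) *ₚ prodLinear xs)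
mainTheorem8 F char0 r _ d _ _ P Q (degP , degQ , _ , _) xs distinct fixed μ _ ∞-fixed =
  fixed-with-multiplier-1-R⇒relaxed-Newton F char0 n (FieldDefs.intK F r) P Q degP degQ′ xs distinct fixed
  where
  n = d ∸ 1
  degQ′ = DegLessThan-pred F Q n (DegAtMost⇒DegLessThan F Q n degQ) (∞-fixed⇒leading-coeff≈0 F n P Q μ ∞-fixed)
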